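{- Let $C\subseteq\mathbb{R}^{(\mathbb{N})}$ be a $\mathrm{Sym}$-invariant cone. Then $C=\mathbb{R}^{(\mathbb{N})}$ if and only if there exist $u,v\in C$ with $s(u)>0$ and $s(v)<0$.
   Context: $\mathbb{R}^{(\mathbb{N})}$ is the space of real sequences $u=(u_i)_{i\in\mathbb{N}}$ with finitely many nonzero entries, and $s(u)=\sum_iu_i$. $\mathrm{Sym}$ is the group of permutations of $\mathbb{N}$ fixing all but finitely many elements, acting by permuting coordinates. A cone is a nonempty subset closed under addition and nonnegative scaling. -}

module Defs where

open import Level using (0ℓ)
open import Data.Nat as ℕ using (ℕ; zero; suc; _⊔_)
open import Data.Nat.Properties using (m⊔n≤o⇒m≤o; m⊔n≤o⇒n≤o)
open import Data.Product using (Σ; ∃; _×_; _,_)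
open import Data.Sum using (_⊎_)
open import Relation.Nullary using (¬_)
open import Relation.Binary.Core using (Rel)
open import Relation.Binary.Structures using (IsStrictTotalOrder)
open import Relation.Binary.PropositionalEquality as P using (_≡_; cong; subst)
open import Algebra.Bundles using (CommutativeRing)

-- The real numbers, axiomatised as a (Dedekind-)complete ordered field.
-- Equality is the setoid equality _≈_ of the underlying commutative ring.

record RealField : Set₁ where
  field
    commRing : CommutativeRing 0ℓ 0ℓ
  open CommutativeRing commRing public
  infix 4 _<_ _≤_
  field
    _<_ : Rel Carrier 0ℓ
    <-isStrictTotalOrder : IsStrictTotalOrder _≈_ _<_
    +-monoˡ-< : ∀ {x y} z → x < y → x + z < y + z
    *-pos : ∀ {x y} → 0# < x → 0# < y → 0# < x * y
    0<1 : 0# < 1#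
    inverse : ∀ x → ¬ (x ≈ 0#) → ∃ λ y → x * y ≈ 1#
  _≤_ : Rel Carrier 0ℓ
  x ≤ y = (x < y) ⊎ (x ≈ y)
  IsUpperBound : (Carrier → Set) → Carrier → Set
  IsUpperBound P b = ∀ x → P x → x ≤ b
  field
    complete : (P : Carrier → Set) → (∃ λ x → P x) → (∃ λ b → IsUpperBound P b) →
               ∃ λ s → IsUpperBound P s × (∀ b → IsUpperBound P b → s ≤ b)

module _ (ℝ : RealField) where
  open RealField ℝ
  open import Relation.Binary.Structures using (IsEquivalence)
  ≈-trans = IsEquivalence.trans isEquivalence
  ≈-refl = IsEquivalence.refl isEquivalence

  -- ℝ^(ℕ): real sequences with finitely many nonzero entries
  -- (all entries from index `bound` on are zero).

  record FinSeq : Set where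
    field
      seq : ℕ → Carrier
      bound : ℕ
      vanish : ∀ i → bound ℕ.≤ i → seq i ≈ 0#
  open FinSeq public

  _≋_ : FinSeq → FinSeq → Set
  u ≋ v = ∀ i → seq u i ≈ seq v i

  _⊕_ : FinSeq → FinSeq → FinSeq
  u ⊕ v = record
    { seq = λ i → seq u i + seq v i
    ; bound = bound u ⊔ bound v
    ; vanish = λ i le → ≈-trans (+-cong (vanish u i (m⊔n≤o⇒m≤o (bound u) (bound v) le))
                                      (vanish v i (m⊔n≤o⇒n≤o (bound u) (bound v) le)))
                              (+-identityˡ 0#)
    }

  _⊙_ : Carrier → FinSeq → FinSeq
  c ⊙ u = record
    { seq = λ i → c * seq u i
    ; bound = bound u
    ; vanish = λ i le → ≈-trans (*-cong ≈-refl (vanish u i le)) (zeroʳ c)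
    }

  sumTo : ℕ → (ℕ → Carrier) → Carrier
  sumTo zero f = 0#
  sumTo (suc n) f = sumTo n f + f n

  s : FinSeq → Carrier
  s u = sumTo (bound u) (seq u)

  -- Sym: permutations of ℕ fixing all but finitely many elements
  -- (all i ≥ bound are fixed).

  record FinPerm : Set where
    field
      to : ℕ → ℕ
      from : ℕ → ℕ
      to-from : ∀ i → to (from i) ≡ i
      from-to : ∀ i → from (to i) ≡ i
      pbound : ℕ
      fixes : ∀ i → pbound ℕ.≤ i → to i ≡ i
  open FinPerm public

  from-fixes : (σ : FinPerm) → ∀ i → pbound σ ℕ.≤ i → from σ i ≡ i
  from-fixes σ i le = P.trans (cong (from σ) (P.sym (fixes σ i le))) (from-to σ i)

  -- action by permuting coordinates: (σ · u)_{σ(i)} = u_i, i.e. (σ · u)_i = u_{σ⁻¹(i)}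
  _·_ : FinPerm → FinSeq → FinSeq
  σ · u = record
    { seq = λ i → seq u (from σ i)
    ; bound = pbound σ ⊔ bound u
    ; vanish = λ i le →
        let e = from-fixes σ i (m⊔n≤o⇒m≤o (pbound σ) (bound u) le) in
        subst (λ j → seq u j ≈ 0#) (P.sym e) (vanish u i (m⊔n≤o⇒n≤o (pbound σ) (bound u) le))
    }

  IsSubset : (FinSeq → Set) → Set
  IsSubset C = ∀ {u v} → u ≋ v → C u → C v

  IsCone : (FinSeq → Set) → Set
  IsCone C = (∃ λ u → C u)
           × (∀ u v → C u → C v → C (u ⊕ v))
           × (∀ c u → 0# ≤ c → C u → C (c ⊙ u))

  SymInvariant : (FinSeq → Set) → Set
  SymInvariant C = ∀ σ u → C u → C (σ · u)

  IsWhole : (FinSeq → Set) → Set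
  IsWhole C = ∀ u → C u

-- If the first k entries of y are equal, the sum of its transposed copies τⱼₖ · y (j ≤ k) has
-- its first k + 1 entries equal. Iterating from u ∈ C until the support of u is covered puts
-- the same positive multiple of s(u) in each of the first K coordinates, so after rescaling
-- C contains the indicator 1[0,K); likewise v gives -1[0,K), for every large K. Since
-- 1[0,K+1) - τₙₖ · 1[0,K) = eₙ for n < K, both ±eₙ lie in C, hence so does c eₙ for every
-- real c, and every finitely supported sequence is a finite sum of such vectors.
module Submission where

open import Defs
open import Data.Product using (∃; _×_)
open import Function.Bundles using (_⇔_)

open import Data.Product using (∃₂; _,_; proj₁; proj₂)
open import Data.Sum using (inj₁; inj₂)
open import Data.Nat as ℕ using (ℕ; zero; suc; _⊔_; s≤s)
import Data.Nat.Properties as ℕₚ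
open import Data.Empty using (⊥-elim)
open import Relation.Nullary using (¬_; Dec; yes; no)
open import Relation.Binary.PropositionalEquality as ≡ using (_≡_; _≢_)
open import Relation.Binary.Definitions using (tri<; tri≈; tri>)
open import Relation.Binary.Structures using (IsStrictTotalOrder)
open import Function.Bundles using (mk⇔)

swap : ℕ → ℕ → ℕ → ℕ
swap a b i with i ℕ.≟ a | i ℕ.≟ b
... | yes _ | _     = b
... | no _  | yes _ = a
... | no _  | no _  = i

swap-left : ∀ a b → swap a b a ≡ b
swap-left a b with a ℕ.≟ a
... | yes _  = ≡.refl
... | no a≢a = ⊥-elim (a≢a ≡.refl)

swap-right : ∀ a b → swap a b b ≡ a
swap-right a b with b ℕ.≟ a | b ℕ.≟ b
... | yes b≡a | _      = b≡a
... | no _    | yes _  = ≡.refl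
... | no _    | no b≢b = ⊥-elim (b≢b ≡.refl)

swap-other : ∀ {a b i} → i ≢ a → i ≢ b → swap a b i ≡ i
swap-other {a} {b} {i} i≢a i≢b with i ℕ.≟ a | i ℕ.≟ b
... | yes i≡a | _       = ⊥-elim (i≢a i≡a)
... | no _    | yes i≡b = ⊥-elim (i≢b i≡b)
... | no _    | no _    = ≡.refl

swap-involutive : ∀ a b i → swap a b (swap a b i) ≡ i
swap-involutive a b i with i ℕ.≟ a | i ℕ.≟ b
... | yes ≡.refl | _          = swap-right a b
... | no _       | yes ≡.refl = swap-left a b
... | no i≢a     | no i≢b     = swap-other i≢a i≢b

swap-< : ∀ {j k i} → j ℕ.≤ k → i ℕ.≤ k → j ≢ i → swap j k i ℕ.< k
swap-< {j} {k} {i} j≤k i≤k j≢i with ℕₚ.m≤n⇒m<n∨m≡n i≤k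
... | inj₁ i<k    =
  ≡.subst (ℕ._< k) (≡.sym (swap-other (λ i≡j → j≢i (≡.sym i≡j)) (ℕₚ.<⇒≢ i<k))) i<k
... | inj₂ ≡.refl = ≡.subst (ℕ._< k) (≡.sym (swap-right j k)) (ℕₚ.≤∧≢⇒< j≤k j≢i)

module _ (ℝ : RealField) where
  open RealField ℝ hiding (zero)
  open IsStrictTotalOrder <-isStrictTotalOrder
    using (compare; irrefl; <-respʳ-≈; <-respˡ-≈) renaming (trans to <-trans)
  open import Algebra.Properties.Ring ring using (-‿distribʳ-*; -‿involutive)
  open import Algebra.Properties.Semiring.Mult semiring
    using (×-congʳ; ×-assoc-*) renaming (_×_ to _×ₙ_)
  open import Relation.Binary.Reasoning.Setoid setoid

  infixl 6 _⊕′_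
  infixr 7 _⊙′_ _·′_
  infix 4 _≋′_

  _⊕′_ : FinSeq ℝ → FinSeq ℝ → FinSeq ℝ
  _⊕′_ = _⊕_ ℝ

  _⊙′_ : Carrier → FinSeq ℝ → FinSeq ℝ
  _⊙′_ = _⊙_ ℝ

  _·′_ : FinPerm ℝ → FinSeq ℝ → FinSeq ℝ
  _·′_ = _·_ ℝ

  _≋′_ : FinSeq ℝ → FinSeq ℝ → Set
  _≋′_ = _≋_ ℝ

  x<0⇒0<-x : ∀ {x} → x < 0# → 0# < - x
  x<0⇒0<-x {x} x<0 = <-respˡ-≈ (-‿inverseʳ x) (<-respʳ-≈ (+-identityˡ (- x)) (+-monoˡ-< (- x) x<0))

  0<x⇒-x<0 : ∀ {x} → 0# < x → - x < 0#
  0<x⇒-x<0 {x} 0<x = <-respʳ-≈ (-‿inverseʳ x) (<-respˡ-≈ (+-identityˡ (- x)) (+-monoˡ-< (- x) 0<x))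

  0<-x⇒x<0 : ∀ {x} → 0# < - x → x < 0#
  0<-x⇒x<0 {x} 0<-x = <-respˡ-≈ (-‿involutive x) (0<x⇒-x<0 0<-x)

  *-neg : ∀ {x y} → 0# < x → y < 0# → x * y < 0#
  *-neg {x} {y} 0<x y<0 = 0<-x⇒x<0 (<-respʳ-≈ (sym (-‿distribʳ-* x y)) (*-pos 0<x (x<0⇒0<-x y<0)))

  +-pos : ∀ {x y} → 0# < x → 0# < y → 0# < x + y
  +-pos {x} {y} 0<x 0<y = <-trans (<-respʳ-≈ (sym (+-identityˡ y)) 0<y) (+-monoˡ-< y 0<x)

  ×ₙ-pos : ∀ n {x} → 0# < x → 0# < suc n ×ₙ x
  ×ₙ-pos zero    0<x = <-respʳ-≈ (sym (+-identityʳ _)) 0<x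
  ×ₙ-pos (suc n) 0<x = +-pos 0<x (×ₙ-pos n 0<x)

  ×ₙ-zero : ∀ n → n ×ₙ 0# ≈ 0#
  ×ₙ-zero zero    = refl
  ×ₙ-zero (suc n) = trans (+-identityˡ _) (×ₙ-zero n)

  inverse-pos : ∀ {x} → 0# < x → ∃ λ t → 0# < t × t * x ≈ 1#
  inverse-pos {x} 0<x with inverse x (λ x≈0 → irrefl (sym x≈0) 0<x)
  ... | t , xt≈1 with compare 0# t
  ...   | tri< 0<t _ _ = t , 0<t , trans (*-comm t x) xt≈1
  ...   | tri≈ _ 0≈t _ = ⊥-elim (irrefl (trans (trans (sym (zeroʳ x)) (*-congˡ 0≈t)) xt≈1) 0<1)
  ...   | tri> _ _ t<0 = ⊥-elim (irrefl refl (<-trans 0<1 (<-respˡ-≈ xt≈1 (*-neg 0<x t<0))))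

  inverse-neg : ∀ {x} → x < 0# → ∃ λ t → 0# < t × t * x ≈ - 1#
  inverse-neg {x} x<0 with inverse-pos (x<0⇒0<-x x<0)
  ... | t , 0<t , t*-x≈1 = t , 0<t , (begin
    t * x       ≈⟨ sym (-‿involutive _) ⟩
    - - (t * x) ≈⟨ -‿cong (-‿distribʳ-* t x) ⟩
    - (t * - x) ≈⟨ -‿cong t*-x≈1 ⟩
    - 1#        ∎)

  sumTo-const : ∀ n {g c} → (∀ j → j ℕ.< n → g j ≈ c) → sumTo ℝ n g ≈ n ×ₙ c
  sumTo-const zero    g≈c = refl
  sumTo-const (suc n) g≈c =
    trans (+-cong (sumTo-const n (λ j j<n → g≈c j (ℕₚ.m<n⇒m<1+n j<n))) (g≈c n ℕₚ.≤-refl))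
          (+-comm _ _)

  sumTo-except : ∀ n {g c i} → i ℕ.< suc n → (∀ j → j ℕ.< suc n → j ≢ i → g j ≈ c) →
                 sumTo ℝ (suc n) g ≈ n ×ₙ c + g i
  sumTo-except zero    (s≤s ℕ.z≤n) g≈c = refl
  sumTo-except (suc n) {g} {c} {i} i<2+n g≈c with i ℕ.≟ suc n
  ... | yes ≡.refl =
    +-congʳ (sumTo-const (suc n) (λ j j<i → g≈c j (ℕₚ.m<n⇒m<1+n j<i) (ℕₚ.<⇒≢ j<i)))
  ... | no i≢1+n   = begin
    sumTo ℝ (suc n) g + g (suc n) ≈⟨ +-cong (sumTo-except n i<1+n (λ j j<1+n → g≈c j (ℕₚ.m<n⇒m<1+n j<1+n)))
                                            (g≈c (suc n) ℕₚ.≤-refl (λ 1+n≡i → i≢1+n (≡.sym 1+n≡i))) ⟩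
    (n ×ₙ c + g i) + c            ≈⟨ +-assoc _ _ _ ⟩
    n ×ₙ c + (g i + c)            ≈⟨ +-congˡ (+-comm _ _) ⟩
    n ×ₙ c + (c + g i)            ≈⟨ sym (+-assoc _ _ _) ⟩
    (n ×ₙ c + c) + g i            ≈⟨ +-congʳ (+-comm _ _) ⟩
    suc n ×ₙ c + g i              ∎
    where
    i<1+n : i ℕ.< suc n
    i<1+n = ℕₚ.≤∧≢⇒< (ℕₚ.≤-pred i<2+n) i≢1+n

  sumTo-vanishing : ∀ {f b K} → (∀ i → b ℕ.≤ i → f i ≈ 0#) → b ℕ.≤′ K →
                    sumTo ℝ K f ≈ sumTo ℝ b f
  sumTo-vanishing f≈0 ℕ.≤′-refl       = refl
  sumTo-vanishing f≈0 (ℕ.≤′-step b≤′K) =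
    trans (+-cong (sumTo-vanishing f≈0 b≤′K) (f≈0 _ (ℕₚ.≤′⇒≤ b≤′K))) (+-identityʳ _)

  transposition : ℕ → ℕ → FinPerm ℝ
  transposition a b = record
    { to = swap a b ; from = swap a b
    ; to-from = swap-involutive a b ; from-to = swap-involutive a b
    ; pbound = suc (a ⊔ b)
    ; fixes = λ i a⊔b<i → swap-other (ℕₚ.>⇒≢ (ℕₚ.≤-<-trans (ℕₚ.m≤m⊔n a b) a⊔b<i))
                                      (ℕₚ.>⇒≢ (ℕₚ.≤-<-trans (ℕₚ.m≤n⊔m a b) a⊔b<i))
    }

  sumTo-swap-≤ : ∀ {y : ℕ → Carrier} {c k i} → (∀ j → j ℕ.< k → y j ≈ c) → i ℕ.≤ k →
                 sumTo ℝ (suc k) (λ j → y (swap j k i)) ≈ k ×ₙ c + y k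
  sumTo-swap-≤ {y} {c} {k} {i} y≈c i≤k =
    trans (sumTo-except k (s≤s i≤k)
             (λ j j<1+k j≢i → y≈c (swap j k i) (swap-< (ℕₚ.≤-pred j<1+k) i≤k j≢i)))
          (+-congˡ (reflexive (≡.cong y (swap-left i k))))

  sumTo-swap-> : ∀ {y : ℕ → Carrier} {k i} → k ℕ.< i →
                 sumTo ℝ (suc k) (λ j → y (swap j k i)) ≈ suc k ×ₙ y i
  sumTo-swap-> {y} {k} {i} k<i = sumTo-const (suc k) λ j j<1+k →
    reflexive (≡.cong y (swap-other (ℕₚ.>⇒≢ (ℕₚ.<-≤-trans j<1+k k<i)) (ℕₚ.>⇒≢ k<i)))

  zeroSeq : FinSeq ℝ
  zeroSeq = record { seq = λ _ → 0# ; bound = 0 ; vanish = λ _ _ → refl }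

  sumSeq : ℕ → (ℕ → FinSeq ℝ) → FinSeq ℝ
  sumSeq zero    f = zeroSeq
  sumSeq (suc n) f = sumSeq n f ⊕′ f n

  seq-sumSeq : ∀ n f i → seq (sumSeq n f) i ≈ sumTo ℝ n (λ j → seq (f j) i)
  seq-sumSeq zero    f i = refl
  seq-sumSeq (suc n) f i = +-congʳ (seq-sumSeq n f i)

  symmetrize : ℕ → FinSeq ℝ → FinSeq ℝ
  symmetrize k y = sumSeq (suc k) (λ j → transposition j k ·′ y)

  -- d = (k - 1)! when y arises from x by k - 1 rounds of symmetrize.
  record Symmetrized (k : ℕ) (x y : FinSeq ℝ) (d : Carrier) : Set where
    constructor symmetrized
    field
      below : ∀ i → i ℕ.< k → seq y i ≈ d * sumTo ℝ k (seq x)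
      above : ∀ i → k ℕ.≤ i → seq y i ≈ (k ×ₙ d) * seq x i

  Symmetrized-one : ∀ x → Symmetrized 1 x x 1#
  Symmetrized-one x = symmetrized
    (λ { .0 (s≤s ℕ.z≤n) → sym (trans (*-identityˡ _) (+-identityˡ _)) })
    (λ i _ → sym (trans (*-congʳ (+-identityʳ 1#)) (*-identityˡ _)))

  symmetrize-step : ∀ {k x y d} → Symmetrized k x y d → Symmetrized (suc k) x (symmetrize k y) (k ×ₙ d)
  symmetrize-step {k} {x} {y} {d} (symmetrized below above) = symmetrized below′ above′
    where
    below′ : ∀ i → i ℕ.< suc k → seq (symmetrize k y) i ≈ (k ×ₙ d) * sumTo ℝ (suc k) (seq x)
    below′ i (s≤s i≤k) = begin
      seq (symmetrize k y) i                     ≈⟨ seq-sumSeq (suc k) _ i ⟩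
      sumTo ℝ (suc k) (λ j → seq y (swap j k i)) ≈⟨ sumTo-swap-≤ below i≤k ⟩
      k ×ₙ (d * S) + seq y k                     ≈⟨ +-cong (sym (×-assoc-* k d S)) (above k ℕₚ.≤-refl) ⟩
      (k ×ₙ d) * S + (k ×ₙ d) * seq x k          ≈⟨ sym (distribˡ _ _ _) ⟩
      (k ×ₙ d) * (S + seq x k)                   ∎
      where
      S : Carrier
      S = sumTo ℝ k (seq x)
    above′ : ∀ i → suc k ℕ.≤ i → seq (symmetrize k y) i ≈ (suc k ×ₙ (k ×ₙ d)) * seq x i
    above′ i k<i = begin
      seq (symmetrize k y) i                     ≈⟨ seq-sumSeq (suc k) _ i ⟩
      sumTo ℝ (suc k) (λ j → seq y (swap j k i)) ≈⟨ sumTo-swap-> {seq y} k<i ⟩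
      suc k ×ₙ seq y i                           ≈⟨ ×-congʳ (suc k) (above i (ℕₚ.<⇒≤ k<i)) ⟩
      suc k ×ₙ ((k ×ₙ d) * seq x i)              ≈⟨ sym (×-assoc-* (suc k) _ _) ⟩
      (suc k ×ₙ (k ×ₙ d)) * seq x i              ∎

  indicator : {P : Set} → Dec P → Carrier
  indicator (yes _) = 1#
  indicator (no _)  = 0#

  indicator-yes : {P : Set} (p? : Dec P) → P → indicator p? ≈ 1#
  indicator-yes (yes _) _ = refl
  indicator-yes (no ¬p) p = ⊥-elim (¬p p)

  indicator-no : {P : Set} (p? : Dec P) → ¬ P → indicator p? ≈ 0#
  indicator-no (yes p) ¬p = ⊥-elim (¬p p)
  indicator-no (no _)  _  = refl

  box : ℕ → FinSeq ℝ
  box K = record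
    { seq = λ i → indicator (i ℕ.<? K) ; bound = K
    ; vanish = λ i K≤i → indicator-no (i ℕ.<? K) (ℕₚ.≤⇒≯ K≤i) }

  basis : ℕ → FinSeq ℝ
  basis n = record
    { seq = λ i → indicator (i ℕ.≟ n) ; bound = suc n
    ; vanish = λ i n<i → indicator-no (i ℕ.≟ n) (ℕₚ.>⇒≢ n<i) }

  s-basis-zero : ∀ c → s ℝ (c ⊙′ basis 0) ≈ c
  s-basis-zero c = trans (+-identityˡ _) (*-identityʳ c)

  basis-from-boxes : ∀ {a b n K} → a + b ≈ 0# → n ℕ.< K →
                     a ⊙′ box (suc K) ⊕′ transposition n K ·′ b ⊙′ box K ≋′ a ⊙′ basis n
  basis-from-boxes {a} {b} {n} {K} a+b≈0 n<K i = pointwise (i ℕ.≟ n) (i ℕ.<? suc K)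
    where
    j : ℕ
    j = swap n K i
    pointwise : Dec (i ≡ n) → Dec (i ℕ.< suc K) →
                a * indicator (i ℕ.<? suc K) + b * indicator (j ℕ.<? K) ≈ a * indicator (i ℕ.≟ n)
    pointwise (yes i≡n) _ = begin
      a * indicator (i ℕ.<? suc K) + b * indicator (j ℕ.<? K)
        ≈⟨ +-cong (*-congˡ (indicator-yes (i ℕ.<? suc K) i<1+K))
                  (*-congˡ (indicator-no (j ℕ.<? K) (ℕₚ.<-irrefl j≡K))) ⟩
      a * 1# + b * 0#
        ≈⟨ trans (+-congˡ (zeroʳ b)) (+-identityʳ _) ⟩
      a * 1#
        ≈⟨ *-congˡ (sym (indicator-yes (i ℕ.≟ n) i≡n)) ⟩
      a * indicator (i ℕ.≟ n) ∎
      where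
      i<1+K : i ℕ.< suc K
      i<1+K = ≡.subst (ℕ._< suc K) (≡.sym i≡n) (ℕₚ.m<n⇒m<1+n n<K)
      j≡K : j ≡ K
      j≡K = ≡.trans (≡.cong (swap n K) i≡n) (swap-left n K)
    pointwise (no i≢n) (yes (s≤s i≤K)) = begin
      a * indicator (i ℕ.<? suc K) + b * indicator (j ℕ.<? K)
        ≈⟨ +-cong (*-congˡ (indicator-yes (i ℕ.<? suc K) (s≤s i≤K)))
                  (*-congˡ (indicator-yes (j ℕ.<? K) j<K)) ⟩
      a * 1# + b * 1#
        ≈⟨ sym (distribʳ 1# a b) ⟩
      (a + b) * 1#
        ≈⟨ trans (*-congʳ a+b≈0) (zeroˡ 1#) ⟩
      0#
        ≈⟨ sym (trans (*-congˡ (indicator-no (i ℕ.≟ n) i≢n)) (zeroʳ a)) ⟩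
      a * indicator (i ℕ.≟ n) ∎
      where
      j<K : j ℕ.< K
      j<K = swap-< (ℕₚ.<⇒≤ n<K) i≤K (λ n≡i → i≢n (≡.sym n≡i))
    pointwise (no i≢n) (no i≮1+K) = begin
      a * indicator (i ℕ.<? suc K) + b * indicator (j ℕ.<? K)
        ≈⟨ +-cong (*-congˡ (indicator-no (i ℕ.<? suc K) i≮1+K))
                  (*-congˡ (indicator-no (j ℕ.<? K) (ℕₚ.<⇒≯ K<j))) ⟩
      a * 0# + b * 0#
        ≈⟨ trans (+-congˡ (zeroʳ b)) (+-identityʳ _) ⟩
      a * 0#
        ≈⟨ *-congˡ (sym (indicator-no (i ℕ.≟ n) i≢n)) ⟩
      a * indicator (i ℕ.≟ n) ∎
      where
      K<i : K ℕ.< i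
      K<i = ℕₚ.≰⇒> (λ i≤K → i≮1+K (s≤s i≤K))
      K<j : K ℕ.< j
      K<j = ≡.subst (K ℕ.<_) (≡.sym (swap-other i≢n (ℕₚ.>⇒≢ K<i))) K<i

  basis-expansion : ∀ w → w ≋′ sumSeq (bound w) (λ n → seq w n ⊙′ basis n)
  basis-expansion w i = sym (trans (seq-sumSeq (bound w) _ i) (expand (i ℕ.<? bound w)))
    where
    term : ℕ → Carrier
    term j = seq w j * indicator (i ℕ.≟ j)
    term-off : ∀ j → j ≢ i → term j ≈ 0#
    term-off j j≢i = trans (*-congˡ (indicator-no (i ℕ.≟ j) (λ i≡j → j≢i (≡.sym i≡j)))) (zeroʳ _)
    expand : Dec (i ℕ.< bound w) → sumTo ℝ (bound w) term ≈ seq w i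
    expand (yes i<b) with bound w
    ... | suc m = begin
      sumTo ℝ (suc m) term ≈⟨ sumTo-except m i<b (λ j _ → term-off j) ⟩
      m ×ₙ 0# + term i     ≈⟨ +-cong (×ₙ-zero m) (*-congˡ (indicator-yes (i ℕ.≟ i) ≡.refl)) ⟩
      0# + seq w i * 1#    ≈⟨ trans (+-identityˡ _) (*-identityʳ _) ⟩
      seq w i              ∎
    expand (no i≮b) = begin
      sumTo ℝ (bound w) term ≈⟨ sumTo-const (bound w) (λ j j<b → term-off j (λ { ≡.refl → i≮b j<b })) ⟩
      bound w ×ₙ 0#          ≈⟨ ×ₙ-zero (bound w) ⟩
      0#                     ≈⟨ sym (vanish w i (ℕₚ.≮⇒≥ i≮b)) ⟩
      seq w i                ∎

  module _ {C : FinSeq ℝ → Set} (C-resp : IsSubset ℝ C) (C-cone : IsCone ℝ C) (C-sym : SymInvariant ℝ C) where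

    ⊕-closed : ∀ {u v} → C u → C v → C (u ⊕′ v)
    ⊕-closed = proj₁ (proj₂ C-cone) _ _

    ⊙-closed : ∀ {c u} → 0# ≤ c → C u → C (c ⊙′ u)
    ⊙-closed = proj₂ (proj₂ C-cone) _ _

    zeroSeq∈C : C zeroSeq
    zeroSeq∈C = let u , u∈C = proj₁ C-cone in C-resp (λ i → zeroˡ (seq u i)) (⊙-closed (inj₂ refl) u∈C)

    sumSeq∈C : ∀ n {f} → (∀ j → C (f j)) → C (sumSeq n f)
    sumSeq∈C zero    f∈C = zeroSeq∈C
    sumSeq∈C (suc n) f∈C = ⊕-closed (sumSeq∈C n f∈C) (f∈C n)

    rescale : ∀ {a b t w} → 0# ≤ t → t * a ≈ b → C (a ⊙′ w) → C (b ⊙′ w)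
    rescale {w = w} 0≤t ta≈b aw∈C =
      C-resp (λ i → trans (sym (*-assoc _ _ (seq w i))) (*-congʳ ta≈b)) (⊙-closed 0≤t aw∈C)

    symmetrized∈C : ∀ {x} → C x → ∀ n → ∃₂ λ y d → C y × 0# < d × Symmetrized (suc n) x y d
    symmetrized∈C {x} x∈C zero = x , 1# , x∈C , 0<1 , Symmetrized-one x
    symmetrized∈C x∈C (suc n) with symmetrized∈C x∈C n
    ... | y , d , y∈C , 0<d , sym-y =
      symmetrize (suc n) y , suc n ×ₙ d ,
      sumSeq∈C (suc (suc n)) (λ j → C-sym (transposition j (suc n)) y y∈C) ,
      ×ₙ-pos n 0<d , symmetrize-step sym-y

    box-multiple∈C : ∀ {x n} → C x → bound x ℕ.≤ suc n →
                     ∃ λ d → 0# < d × C ((d * s ℝ x) ⊙′ box (suc n))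
    box-multiple∈C {x} {n} x∈C bx≤K with symmetrized∈C x∈C n
    ... | y , d , y∈C , 0<d , symmetrized below above = d , 0<d , C-resp y≋ y∈C
      where
      y≋ : y ≋′ (d * s ℝ x) ⊙′ box (suc n)
      y≋ i with i ℕ.<? suc n
      ... | yes i<K = begin
        seq y i                       ≈⟨ below i i<K ⟩
        d * sumTo ℝ (suc n) (seq x)   ≈⟨ *-congˡ (sumTo-vanishing (vanish x) (ℕₚ.≤⇒≤′ bx≤K)) ⟩
        d * s ℝ x                     ≈⟨ sym (*-identityʳ _) ⟩
        (d * s ℝ x) * 1#              ∎
      ... | no i≮K = begin
        seq y i                       ≈⟨ above i (ℕₚ.≮⇒≥ i≮K) ⟩
        (suc n ×ₙ d) * seq x i        ≈⟨ *-congˡ (vanish x i (ℕₚ.≤-trans bx≤K (ℕₚ.≮⇒≥ i≮K))) ⟩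
        (suc n ×ₙ d) * 0#             ≈⟨ zeroʳ _ ⟩
        0#                            ≈⟨ sym (zeroʳ _) ⟩
        (d * s ℝ x) * 0#              ∎

    box∈C : ∀ {x n} → C x → 0# < s ℝ x → bound x ℕ.≤ suc n → C (1# ⊙′ box (suc n))
    box∈C x∈C 0<sx bx≤K with box-multiple∈C x∈C bx≤K
    ... | d , 0<d , box∈C′ with inverse-pos (*-pos 0<d 0<sx)
    ...   | t , 0<t , t*a≈1 = rescale (inj₁ 0<t) t*a≈1 box∈C′

    -box∈C : ∀ {x n} → C x → s ℝ x < 0# → bound x ℕ.≤ suc n → C ((- 1#) ⊙′ box (suc n))
    -box∈C x∈C sx<0 bx≤K with box-multiple∈C x∈C bx≤K
    ... | d , 0<d , box∈C′ with inverse-neg (*-neg 0<d sx<0)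
    ...   | t , 0<t , t*a≈-1 = rescale (inj₁ 0<t) t*a≈-1 box∈C′

    module _ {u v} (u∈C : C u) (v∈C : C v) (0<su : 0# < s ℝ u) (sv<0 : s ℝ v < 0#) where

      ±basis∈C : ∀ n → C (1# ⊙′ basis n) × C ((- 1#) ⊙′ basis n)
      ±basis∈C n =
          C-resp (basis-from-boxes (-‿inverseʳ 1#) n<K)
                 (⊕-closed (box∈C u∈C 0<su bu≤K+1) (C-sym (transposition n (suc M)) _ (-box∈C v∈C sv<0 bv≤K)))
        , C-resp (basis-from-boxes (-‿inverseˡ 1#) n<K)
                 (⊕-closed (-box∈C v∈C sv<0 bv≤K+1) (C-sym (transposition n (suc M)) _ (box∈C u∈C 0<su bu≤K)))
        where
        M : ℕ
        M = n ⊔ (bound u ⊔ bound v)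
        n<K : n ℕ.< suc M
        n<K = s≤s (ℕₚ.m≤m⊔n n _)
        bu≤K : bound u ℕ.≤ suc M
        bu≤K = ℕₚ.m≤n⇒m≤1+n (ℕₚ.m⊔n≤o⇒m≤o _ _ (ℕₚ.m⊔n≤o⇒n≤o n _ ℕₚ.≤-refl))
        bv≤K : bound v ℕ.≤ suc M
        bv≤K = ℕₚ.m≤n⇒m≤1+n (ℕₚ.m⊔n≤o⇒n≤o _ _ (ℕₚ.m⊔n≤o⇒n≤o n _ ℕₚ.≤-refl))
        bu≤K+1 : bound u ℕ.≤ suc (suc M)
        bu≤K+1 = ℕₚ.m≤n⇒m≤1+n bu≤K
        bv≤K+1 : bound v ℕ.≤ suc (suc M)
        bv≤K+1 = ℕₚ.m≤n⇒m≤1+n bv≤K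

      scaled-basis∈C : ∀ c n → C (c ⊙′ basis n)
      scaled-basis∈C c n with compare 0# c
      ... | tri< 0<c _ _ = rescale (inj₁ 0<c) (*-identityʳ c) (proj₁ (±basis∈C n))
      ... | tri≈ _ 0≈c _ = rescale (inj₂ 0≈c) (*-identityʳ c) (proj₁ (±basis∈C n))
      ... | tri> _ _ c<0 = rescale (inj₁ (x<0⇒0<-x c<0)) -c*-1≈c (proj₂ (±basis∈C n))
        where
        -c*-1≈c : - c * - 1# ≈ c
        -c*-1≈c = trans (sym (-‿distribʳ-* (- c) 1#)) (trans (-‿cong (*-identityʳ (- c))) (-‿involutive c))

      whole : IsWhole ℝ C
      whole w = C-resp (λ i → sym (basis-expansion w i))
                       (sumSeq∈C (bound w) (λ n → scaled-basis∈C (seq w n) n))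

lemma5p3 : (ℝ : RealField) → (C : FinSeq ℝ → Set) →
    IsSubset ℝ C → IsCone ℝ C → SymInvariant ℝ C →
    (IsWhole ℝ C ⇔ (∃ λ u → ∃ λ v → C u × C v × RealField._<_ ℝ (RealField.0# ℝ) (s ℝ u) × RealField._<_ ℝ (s ℝ v) (RealField.0# ℝ)))
lemma5p3 ℝ C C-resp C-cone C-sym = mk⇔ signed-pair
  (λ (u , v , u∈C , v∈C , 0<su , sv<0) → whole ℝ C-resp C-cone C-sym u∈C v∈C 0<su sv<0)
  where
  open RealField ℝ
  open IsStrictTotalOrder <-isStrictTotalOrder using (<-respʳ-≈; <-respˡ-≈)
  signed-pair : IsWhole ℝ C → ∃ λ u → ∃ λ v → C u × C v × 0# < s ℝ u × s ℝ v < 0#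
  signed-pair C-whole =
    _ , _ , C-whole (_⊙_ ℝ 1# (basis ℝ 0)) , C-whole (_⊙_ ℝ (- 1#) (basis ℝ 0)) ,
    <-respʳ-≈ (sym (s-basis-zero ℝ 1#)) 0<1 , <-respˡ-≈ (sym (s-basis-zero ℝ (- 1#))) (0<x⇒-x<0 ℝ 0<1)
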